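{- Let $\mathcal{G}_U=(L_1,L_2,l_0,X,\mathit{Act},\mathit{Obs},\mathit{flow},E,\mathit{lbl})$ be an updatable timed game, let $\mathcal{G}_T$ be the timed game constructed from it as described in the context, and let $\gamma_2^{ -1}=\{(((l,g),v^t),(l,v)) : ((l,g),v^t)\in Q(\mathcal{G}_T),\ v(x)=v^t(x)+g(x)\text{ for all }x\in X\}$. Then $\gamma_2^{ -1}$ witnesses $T(\mathcal{G}_T)\preceq_s T(\mathcal{G}_U)$.
   Context: A simple compact constraint over a finite set $X$ of real variables is a conjunction containing, for each $x\in X$, exactly one conjunct $x\in I$ with $I$ a compact interval with rational endpoints; $\varphi(x)$ denotes that interval. An initialized singular game is a tuple $\mathcal{G}=(L_1,L_2,l_0,X,\mathit{Act},\mathit{Obs},\mathit{flow},E,\mathit{lbl})$ where $L_1,L_2$ are disjoint finite sets of locations (owned by Player 1 and Player 2 respectively), $l_0\in L_1$, $X$ is a finite set of real variables, $\mathit{Act}$ a finite set of actions, $\mathit{Obs}$ a finite set of observations, $\mathit{lbl}:L_1\cup L_2\to\mathit{Obs}$, $\mathit{flow}:(L_1\cup L_2)\times X\to\mathbb{Q}$, and $E$ is a set of edges $e=(l,a,\varphi_e,\mathit{rst}_e,l')$ with $l,l'\in L_1\cup L_2$, $a\in\mathit{Act}$, $\varphi_e$ a simple compact constraint over $X$, and $\mathit{rst}_e:X\to\mathbb{Q}\cup\{\bot\}$, such that $\mathit{flow}(l,x)\neq\mathit{flow}(l',x)$ implies $\mathit{rst}_e(x)\neq\bot$. An updatable timed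 game is an initialized singular game with $\mathit{flow}(l,x)=1$ for all $l,x$; a timed game is an updatable timed game in which every reset value $\mathit{rst}_e(x)\neq\bot$ equals $0$. Semantics: the transition system $T(\mathcal{G})$ has configurations $Q(\mathcal{G})=(L_1\cup L_2)\times\mathbb{R}^X$, initial configuration $(l_0,\vec 0)$, moves $\mathit{Act}\times\mathbb{R}_{\ge 0}$, and a transition $(l,v)\xrightarrow{(a,t)}(l',v')$ whenever there is an edge $e=(l,a,\varphi_e,\mathit{rst}_e,l')$ such that for every $x\in X$: $v(x)+t\cdot\mathit{flow}(l,x)\in\varphi_e(x)$, and $v'(x)=\mathit{rst}_e(x)$ if $\mathit{rst}_e(x)\neq\bot$, $v'(x)=v(x)+t\cdot\mathit{flow}(l,x)$ otherwise. $Q_i(\mathcal{G})$ is the set of configurations whose location lies in $L_i$; $\mathit{lbl}$ is extended to configurations via their location. Alternating simulation: for two such games $\mathcal{G}^1,\mathcal{G}^2$ with the same observation set, a relation $R\subseteq (Q_1(\mathcal{G}^1)\times Q_1(\mathcal{G}^2))\cup(Q_2(\mathcal{G}^1)\times Q_2(\mathcal{G}^2))$ is a simulation if for every $(p,q)\in R$: (1) $\mathit{lbl}^1(p)=\mathit{lbl}^2(q)$; (2) if $p\in Q_1(\mathcal{G}^1)$, then for every move $m$ and every transition $p\xrightarrow{m}p'$ in $T(\mathcal{G}^1)$ there exist a move $m'$ and a transition $q\xrightarrow{m'}q'$ in $T(\mathcal{G}^2)$ with $(p',q')\in R$; (3) if $p\in Q_2(\mathcal{G}^1)$, then for every move $m'$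 and every transition $q\xrightarrow{m'}q'$ in $T(\mathcal{G}^2)$ there exist a move $m$ and a transition $p\xrightarrow{m}p'$ in $T(\mathcal{G}^1)$ with $(p',q')\in R$. $R$ witnesses $T(\mathcal{G}^1)\preceq_s T(\mathcal{G}^2)$ if $R$ is a simulation containing the pair of initial configurations. Construction of $\mathcal{G}_T$: let $K_U$ be the set of constants used in $\mathcal{G}_U$ together with $0$, and $F_t$ the set of functions $g:X\to K_U$. Then $\mathcal{G}_T=(L_1\times F_t,L_2\times F_t,(l_0,g_0),X,\mathit{Act},\mathit{Obs},\mathit{flow}_T,E^t,\mathit{lbl}_T)$ with $g_0\equiv0$, $\mathit{flow}_T\equiv 1$, $\mathit{lbl}_T(l,g)=\mathit{lbl}(l)$, and $E^t$ consisting of all edges $((l_1,g_1),a,\varphi_{e^t},\mathit{rst}_{e^t},(l_2,g_2))$ such that there is $e=(l_1,a,\varphi_e,\mathit{rst}_e,l_2)\in E$, $g_1\in F_t$, and for every $x\in X$: $\varphi_{e^t}(x)=\{c-g_1(x): c\in\varphi_e(x)\}$; $g_2(x)=\mathit{rst}_e(x)$ if $\mathit{rst}_e(x)\neq\bot$ and $g_2(x)=g_1(x)$ if $\mathit{rst}_e(x)=\bot$; $\mathit{rst}_{e^t}(x)=0$ if $\mathit{rst}_e(x)\neq\bot$ and $\mathit{rst}_{e^t}(x)=\bot$ otherwise (i.e., the clocks in $r=\{x:\mathit{rst}_e(x)\neq\bot\}$ are reset to $0$). -}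

module Defs where

open import Level using (0ℓ)
open import Data.Nat using (ℕ)
open import Data.Fin using (Fin)
open import Data.Maybe using (Maybe; just; nothing)
open import Data.Product using (Σ; ∃; _×_; _,_; proj₁; proj₂)
open import Data.Sum using (_⊎_; inj₁; inj₂)
open import Data.Empty using (⊥)
open import Relation.Nullary using (¬_)
open import Relation.Binary.PropositionalEquality using (_≡_; _≢_)
open import Relation.Binary.Structures using (IsTotalOrder)
open import Algebra.Structures using (IsCommutativeRing)
open import Data.Rational as ℚ using (ℚ; 0ℚ; 1ℚ)

-- The value domain of variables and time.
-- The paper uses ℝ.  Agda's stdlib has no reals, so we quantify over
-- an arbitrary ordered commutative ring containing ℚ (via an order
-- embedding ring homomorphism ι); ℝ is one instance.

record OrderedQRing : Set₁ where
  infixl 6 _+_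
  infixl 7 _*_
  infix  4 _≤_
  field
    Carrier : Set
    _+_ _*_ : Carrier → Carrier → Carrier
    -_      : Carrier → Carrier
    0# 1#   : Carrier
    _≤_     : Carrier → Carrier → Set
    isCommutativeRing : IsCommutativeRing _≡_ _+_ _*_ -_ 0# 1#
    isTotalOrder      : IsTotalOrder _≡_ _≤_
    +-mono-≤   : ∀ {x y} z → x ≤ y → x + z ≤ y + z
    *-nonneg   : ∀ {x y} → 0# ≤ x → 0# ≤ y → 0# ≤ x * y
    ι          : ℚ → Carrier
    ι-+        : ∀ p q → ι (p ℚ.+ q) ≡ ι p + ι q
    ι-*        : ∀ p q → ι (p ℚ.* q) ≡ ι p * ι q
    ι-0        : ι 0ℚ ≡ 0#
    ι-1        : ι 1ℚ ≡ 1#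
    ι-mono     : ∀ {p q} → p ℚ.≤ q → ι p ≤ ι q
    ι-reflect  : ∀ {p q} → ι p ≤ ι q → p ℚ.≤ q

record Interval : Set where
  constructor [_,_]⟨_⟩
  field
    lo hi : ℚ
    lo≤hi : lo ℚ.≤ hi
open Interval public

record Edge (Loc Act : Set) (n : ℕ) : Set where
  field
    src   : Loc
    act   : Act
    guard : Fin n → Interval
    rst   : Fin n → Maybe ℚ           -- nothing = ⊥ (no reset)
    tgt   : Loc
open Edge public

-- Locations are L₁ ⊎ L₂ (disjoint union: owned by Player 1 / Player 2).
-- The edge set E is given as a predicate on edges.
record Game (n : ℕ) (Obs : Set) : Set₁ where
  field
    L₁ L₂ Act : Set
    l₀   : L₁
    lbl  : L₁ ⊎ L₂ → Obs
    flow : L₁ ⊎ L₂ → Fin n → ℚ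
    E    : Edge (L₁ ⊎ L₂) Act n → Set
    flow-wf : ∀ e → E e → ∀ x → flow (src e) x ≢ flow (tgt e) x → rst e x ≢ nothing

  Loc : Set
  Loc = L₁ ⊎ L₂

open Game public

IsUpdatableTimed : ∀ {n Obs} → Game n Obs → Set
IsUpdatableTimed G = ∀ l x → flow G l x ≡ 1ℚ

module Semantics (R : OrderedQRing) where
  open OrderedQRing R

  _∈I_ : Carrier → Interval → Set
  y ∈I I = ι (lo I) ≤ y × y ≤ ι (hi I)

  Config : ∀ {n Obs} → Game n Obs → Set
  Config {n} G = Loc G × (Fin n → Carrier)

  Move : ∀ {n Obs} → Game n Obs → Set
  Move G = Act G × Carrier        -- (a , t); t ≥ 0 is required in Step

  initial : ∀ {n Obs} (G : Game n Obs) → Config G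
  initial G = inj₁ (l₀ G) , (λ _ → 0#)

  resetVal : Maybe ℚ → Carrier → Carrier
  resetVal (just c) _ = ι c
  resetVal nothing  y = y

  Step : ∀ {n Obs} (G : Game n Obs) → Config G → Move G → Config G → Set
  Step {n} G (l , v) (a , t) (l' , v') =
    0# ≤ t ×
    Σ (Edge (Loc G) (Act G) n) λ e →
      E G e × src e ≡ l × act e ≡ a × tgt e ≡ l' ×
      (∀ x → (v x + t * ι (flow G l x)) ∈I guard e x
           × v' x ≡ resetVal (rst e x) (v x + t * ι (flow G l x)))

  IsP1 IsP2 : ∀ {n Obs} {G : Game n Obs} → Config G → Set
  IsP1 (inj₁ _ , _) = Data.Unit.⊤ where import Data.Unit
  IsP1 (inj₂ _ , _) = ⊥
  IsP2 (inj₁ _ , _) = ⊥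
  IsP2 (inj₂ _ , _) = Data.Unit.⊤ where import Data.Unit

  lblC : ∀ {n Obs} (G : Game n Obs) → Config G → Obs
  lblC G (l , _) = lbl G l

  -- alternating simulation relation (conditions (0)-(3); (0) is
  -- R ⊆ (Q₁ × Q₁) ∪ (Q₂ × Q₂))
  IsSimulation : ∀ {n Obs} (G¹ G² : Game n Obs) →
                 (Config G¹ → Config G² → Set) → Set
  IsSimulation G¹ G² Rel = ∀ p q → Rel p q →
      ((IsP1 {G = G¹} p × IsP1 {G = G²} q) ⊎ (IsP2 {G = G¹} p × IsP2 {G = G²} q))
    × lblC G¹ p ≡ lblC G² q
    × (IsP1 {G = G¹} p → ∀ m p' → Step G¹ p m p' →
         Σ (Move G²) λ m' → Σ (Config G²) λ q' → Step G² q m' q' × Rel p' q')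
    × (IsP2 {G = G¹} p → ∀ m' q' → Step G² q m' q' →
         Σ (Move G¹) λ m → Σ (Config G¹) λ p' → Step G¹ p m p' × Rel p' q')

  Witnesses : ∀ {n Obs} (G¹ G² : Game n Obs) →
              (Config G¹ → Config G² → Set) → Set
  Witnesses G¹ G² Rel = IsSimulation G¹ G² Rel × Rel (initial G¹) (initial G²)

module Construction {n : ℕ} {Obs : Set} (G : Game n Obs) where

  K : ℚ → Set
  K c = c ≡ 0ℚ ⊎
        Σ (Edge (Loc G) (Act G) n) λ e → E G e × Σ (Fin n) λ x →
          (lo (guard e x) ≡ c ⊎ hi (guard e x) ≡ c ⊎ rst e x ≡ just c)

  F : Set
  F = Fin n → Σ ℚ K

  LocT : Set
  LocT = (L₁ G × F) ⊎ (L₂ G × F)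

  attach : Loc G → F → LocT
  attach (inj₁ l) g = inj₁ (l , g)
  attach (inj₂ l) g = inj₂ (l , g)

  strip : LocT → Loc G
  strip (inj₁ (l , _)) = inj₁ l
  strip (inj₂ (l , _)) = inj₂ l

  gOf : LocT → F
  gOf (inj₁ (_ , g)) = g
  gOf (inj₂ (_ , g)) = g

  newG : Maybe ℚ → ℚ → ℚ
  newG (just c) _ = c
  newG nothing  d = d

  rstT : Maybe ℚ → Maybe ℚ
  rstT (just _) = just 0ℚ
  rstT nothing  = nothing

  ET : Edge LocT (Act G) n → Set
  ET et = Σ (Edge (Loc G) (Act G) n) λ e → E G e ×
          Σ F λ g₁ → Σ F λ g₂ →
            src et ≡ attach (src e) g₁ × act et ≡ act e × tgt et ≡ attach (tgt e) g₂ ×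
            (∀ x → lo (guard et x) ≡ lo (guard e x) ℚ.- proj₁ (g₁ x)
                 × hi (guard et x) ≡ hi (guard e x) ℚ.- proj₁ (g₁ x)
                 × proj₁ (g₂ x) ≡ newG (rst e x) (proj₁ (g₁ x))
                 × rst et x ≡ rstT (rst e x))

  GT : Game n Obs
  GT = record
    { L₁ = L₁ G × F
    ; L₂ = L₂ G × F
    ; Act = Act G
    ; l₀ = l₀ G , (λ _ → 0ℚ , inj₁ _≡_.refl)
    ; lbl = λ lt → lbl G (strip lt)
    ; flow = λ _ _ → 1ℚ
    ; E = ET
    ; flow-wf = λ _ _ _ neq _ → neq _≡_.refl
    }

  γ₂⁻¹ : (R : OrderedQRing) → Semantics.Config R GT → Semantics.Config R G → Set
  γ₂⁻¹ R (lt , vt) (l , v) =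
    strip lt ≡ l × (∀ x → v x ≡ vt x + ι (proj₁ (gOf lt x)))
    where open OrderedQRing R

-- G_T runs every clock from 0 and records in the location component g the constant the
-- corresponding clock of G_U was last reset to, so a configuration ((l, g), vᵗ) stands for
-- (l, vᵗ + g).  Since all flows are 1, a delay t adds t to both valuations and preserves
-- vᵗ + g = v; the guards of G_T are those of G_U shifted by g, so an edge is enabled in one
-- game iff its counterpart is enabled in the other; and a reset of x to c in G_U becomes
-- vᵗ(x) := 0, g(x) := c in G_T.  Hence each move of either game is matched by the same
-- move (same action, same delay) of the other, which gives both simulation clauses.
module Submission where

open import Level using (0ℓ)
open import Data.Nat using (ℕ)
open import Data.Fin using (Fin)
open import Data.Maybe using (Maybe; just; nothing)
open import Data.Product using (Σ; _×_; _,_; proj₁; proj₂)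
open import Data.Product.Function.NonDependent.Propositional using (_×-⇔_)
open import Data.Sum using (inj₁; inj₂)
open import Data.Unit using (tt)
open import Function.Bundles using (_⇔_; mk⇔; Equivalence)
open import Relation.Binary.PropositionalEquality
open import Algebra.Bundles using (CommutativeRing)
import Algebra.Properties.Group as GroupProperties
import Algebra.Properties.CommutativeSemigroup as CommutativeSemigroupProperties
open import Data.Rational as ℚ using (ℚ; 0ℚ; 1ℚ)
import Data.Rational.Properties as ℚ

open import Defs

module OrderedQRingProperties (R : OrderedQRing) where
  open OrderedQRing R
  open Semantics R using (_∈I_)

  ring : CommutativeRing 0ℓ 0ℓ
  ring = record { isCommutativeRing = isCommutativeRing }

  open CommutativeRing ring using (+-identityˡ; +-group; +-commutativeSemigroup)
  open GroupProperties +-group using (//-rightDividesʳ)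
  open CommutativeSemigroupProperties +-commutativeSemigroup public using (xy∙z≈xz∙y)

  +-cancelʳ-≤ : ∀ c {x y} → x + c ≤ y + c → x ≤ y
  +-cancelʳ-≤ c {x} {y} x+c≤y+c =
    subst₂ _≤_ (//-rightDividesʳ c x) (//-rightDividesʳ c y) (+-mono-≤ (- c) x+c≤y+c)

  +-monoʳ-⇔-≤ : ∀ c {x y} → x ≤ y ⇔ x + c ≤ y + c
  +-monoʳ-⇔-≤ c = mk⇔ (+-mono-≤ c) (+-cancelʳ-≤ c)

  ι0+x≡x : ∀ x → ι 0ℚ + x ≡ x
  ι0+x≡x x = trans (cong (_+ x) ι-0) (+-identityˡ x)

  ι[p-c]+ιc≡ιp : ∀ p c → ι (p ℚ.- c) + ι c ≡ ι p
  ι[p-c]+ιc≡ιp p c =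
    trans (sym (ι-+ (p ℚ.- c) c)) (cong ι (GroupProperties.//-rightDividesˡ ℚ.+-0-group c p))

  ι-shift-≤ˡ : ∀ p c y → ι (p ℚ.- c) ≤ y ⇔ ι p ≤ y + ι c
  ι-shift-≤ˡ p c y =
    subst (λ z → ι (p ℚ.- c) ≤ y ⇔ z ≤ y + ι c) (ι[p-c]+ιc≡ιp p c) (+-monoʳ-⇔-≤ (ι c))

  ι-shift-≤ʳ : ∀ p c y → y ≤ ι (p ℚ.- c) ⇔ y + ι c ≤ ι p
  ι-shift-≤ʳ p c y =
    subst (λ z → y ≤ ι (p ℚ.- c) ⇔ y + ι c ≤ z) (ι[p-c]+ιc≡ιp p c) (+-monoʳ-⇔-≤ (ι c))

  ∈I-shift : ∀ I J c → lo J ≡ lo I ℚ.- c → hi J ≡ hi I ℚ.- c → ∀ y → y ∈I J ⇔ (y + ι c) ∈I I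
  ∈I-shift I [ _ , _ ]⟨ _ ⟩ c refl refl y = ι-shift-≤ˡ (lo I) c y ×-⇔ ι-shift-≤ʳ (hi I) c y

module _ (R : OrderedQRing) {n : ℕ} {Obs : Set} (G : Game n Obs) where
  open OrderedQRing R
  open OrderedQRingProperties R
  open Semantics R
  open Construction G
  open CommutativeRing ring using (+-identityʳ)

  Offset : F → (Fin n → Carrier) → (Fin n → Carrier) → Set
  Offset g vt v = ∀ x → v x ≡ vt x + ι (proj₁ (g x))

  γ₂⁻¹-attach : ∀ l {g vt v} → Offset g vt v → γ₂⁻¹ R (attach l g , vt) (l , v)
  γ₂⁻¹-attach (inj₁ _) off = refl , off
  γ₂⁻¹-attach (inj₂ _) off = refl , off

  attach-injective : ∀ {l l' g g'} → attach l g ≡ attach l' g' → l ≡ l' × g ≡ g'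
  attach-injective {inj₁ _} {inj₁ _} refl = refl , refl
  attach-injective {inj₁ _} {inj₂ _} ()
  attach-injective {inj₂ _} {inj₁ _} ()
  attach-injective {inj₂ _} {inj₂ _} refl = refl , refl

  Corresponds : Edge (Loc G) (Act G) n → F → F → Edge LocT (Act G) n → Set
  Corresponds e g₁ g₂ et = ∀ x →
      lo (guard et x) ≡ lo (guard e x) ℚ.- proj₁ (g₁ x)
    × hi (guard et x) ≡ hi (guard e x) ℚ.- proj₁ (g₁ x)
    × proj₁ (g₂ x) ≡ newG (rst e x) (proj₁ (g₁ x))
    × rst et x ≡ rstT (rst e x)

  resetVal-offset : ∀ r w c → resetVal r (w + ι c) ≡ resetVal (rstT r) w + ι (newG r c)
  resetVal-offset (just c') w c = sym (ι0+x≡x (ι c'))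
  resetVal-offset nothing   w c = refl

  module _ (e : Edge (Loc G) (Act G) n) (g₁ g₂ : F) (et : Edge LocT (Act G) n)
           (corr : Corresponds e g₁ g₂ et) where

    guard-transfer : ∀ x w → w ∈I guard et x ⇔ (w + ι (proj₁ (g₁ x))) ∈I guard e x
    guard-transfer x =
      ∈I-shift (guard e x) (guard et x) (proj₁ (g₁ x)) (proj₁ (corr x)) (proj₁ (proj₂ (corr x)))

    reset-transfer : ∀ x w →
      resetVal (rst e x) (w + ι (proj₁ (g₁ x))) ≡ resetVal (rst et x) w + ι (proj₁ (g₂ x))
    reset-transfer x w with corr x
    ... | _ , _ , g₂≡ , rst≡ rewrite g₂≡ | rst≡ = resetVal-offset (rst e x) w (proj₁ (g₁ x))

  updateOffset : ∀ e → E G e → ∀ x (r : Maybe ℚ) → rst e x ≡ r → Σ ℚ K → Σ ℚ K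
  updateOffset e Ee x (just c) eq _ = c , inj₂ (e , Ee , x , inj₂ (inj₂ eq))
  updateOffset e Ee x nothing  _  d = d

  updateOffset-value : ∀ e Ee x r eq d → proj₁ (updateOffset e Ee x r eq d) ≡ newG r (proj₁ d)
  updateOffset-value e Ee x (just _) _ _ = refl
  updateOffset-value e Ee x nothing  _ _ = refl

  nextOffset : (e : Edge (Loc G) (Act G) n) → E G e → F → F
  nextOffset e Ee g x = updateOffset e Ee x (rst e x) refl (g x)

  nextOffset-value : ∀ e Ee g x → proj₁ (nextOffset e Ee g x) ≡ newG (rst e x) (proj₁ (g x))
  nextOffset-value e Ee g x = updateOffset-value e Ee x (rst e x) refl (g x)

  liftEdge : (e : Edge (Loc G) (Act G) n) → E G e → F → Edge LocT (Act G) n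
  liftEdge e Ee g = record
    { src   = attach (src e) g
    ; act   = act e
    ; guard = λ x → shift (guard e x) (proj₁ (g x))
    ; rst   = λ x → rstT (rst e x)
    ; tgt   = attach (tgt e) (nextOffset e Ee g)
    }
    where
    shift : Interval → ℚ → Interval
    shift I c = [ lo I ℚ.- c , hi I ℚ.- c ]⟨ ℚ.+-monoˡ-≤ (ℚ.- c) (lo≤hi I) ⟩

  liftEdge-corresponds : ∀ e Ee g → Corresponds e g (nextOffset e Ee g) (liftEdge e Ee g)
  liftEdge-corresponds e Ee g x = refl , refl , nextOffset-value e Ee g x , refl

  liftEdge∈ET : ∀ e Ee g → ET (liftEdge e Ee g)
  liftEdge∈ET e Ee g =
    e , Ee , g , nextOffset e Ee g , refl , refl , refl , liftEdge-corresponds e Ee g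

  γ₂⁻¹-initial : γ₂⁻¹ R (initial GT) (initial G)
  γ₂⁻¹-initial = refl , λ _ → sym (trans (cong (0# +_) ι-0) (+-identityʳ 0#))

  module _ (updatable : IsUpdatableTimed G) where

    elapse-offset : ∀ g vt v → Offset g vt v → ∀ l t x →
      v x + t * ι (flow G l x) ≡ (vt x + t * ι 1ℚ) + ι (proj₁ (g x))
    elapse-offset g vt v off l t x = begin
      v x + t * ι (flow G l x)               ≡⟨ cong (λ f → v x + t * ι f) (updatable l x) ⟩
      v x + t * ι 1ℚ                         ≡⟨ cong (_+ t * ι 1ℚ) (off x) ⟩
      (vt x + ι (proj₁ (g x))) + t * ι 1ℚ    ≡⟨ xy∙z≈xz∙y (vt x) _ _ ⟩
      (vt x + t * ι 1ℚ) + ι (proj₁ (g x))    ∎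
      where open ≡-Reasoning

    module _ (e : Edge (Loc G) (Act G) n) (g₁ g₂ : F) (et : Edge LocT (Act G) n)
             (corr : Corresponds e g₁ g₂ et) (vt v : Fin n → Carrier) (off : Offset g₁ vt v)
             (l : Loc G) (t : Carrier) where

      elapsed-guard-transfer : ∀ x →
        (vt x + t * ι 1ℚ) ∈I guard et x ⇔ (v x + t * ι (flow G l x)) ∈I guard e x
      elapsed-guard-transfer x rewrite elapse-offset g₁ vt v off l t x =
        guard-transfer e g₁ g₂ et corr x _

      elapsed-reset-transfer : ∀ x → resetVal (rst e x) (v x + t * ι (flow G l x))
                                    ≡ resetVal (rst et x) (vt x + t * ι 1ℚ) + ι (proj₁ (g₂ x))
      elapsed-reset-transfer x rewrite elapse-offset g₁ vt v off l t x =
        reset-transfer e g₁ g₂ et corr x _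

    simulate-GT-move : ∀ l g vt v → Offset g vt v → ∀ m p' → Step GT (attach l g , vt) m p' →
      Σ (Move G) λ m' → Σ (Config G) λ q' → Step G (l , v) m' q' × γ₂⁻¹ R p' q'
    simulate-GT-move l g vt v off (a , t) (lt' , vt')
      (t≥0 , et , (e , Ee , g₁ , g₂ , src-et , act-et , tgt-et , corr) , from-lt , acts-a , refl , et-sem)
      with attach-injective (trans (sym src-et) from-lt)
    ... | refl , refl =
      (a , t) , (tgt e , v') ,
      (t≥0 , e , Ee , refl , trans (sym act-et) acts-a , refl , λ x → enabled x , refl) ,
      subst (λ lt → γ₂⁻¹ R (lt , vt') (tgt e , v')) (sym tgt-et) (γ₂⁻¹-attach (tgt e) offset')
      where
      v' : Fin n → Carrier
      v' x = resetVal (rst e x) (v x + t * ι (flow G (src e) x))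
      enabled : ∀ x → (v x + t * ι (flow G (src e) x)) ∈I guard e x
      enabled x = Equivalence.to (elapsed-guard-transfer e g₁ g₂ et corr vt v off (src e) t x)
                                 (proj₁ (et-sem x))
      offset' : Offset g₂ vt' v'
      offset' x = trans (elapsed-reset-transfer e g₁ g₂ et corr vt v off (src e) t x)
                        (cong (_+ ι (proj₁ (g₂ x))) (sym (proj₂ (et-sem x))))

    simulate-G-move : ∀ l g vt v → Offset g vt v → ∀ m' q' → Step G (l , v) m' q' →
      Σ (Move GT) λ m → Σ (Config GT) λ p' → Step GT (attach l g , vt) m p' × γ₂⁻¹ R p' q'
    simulate-G-move l g vt v off (a , t) (_ , v') (t≥0 , e , Ee , refl , refl , refl , e-sem) =
      (a , t) , (tgt et , vt') ,
      (t≥0 , et , liftEdge∈ET e Ee g , refl , refl , refl , λ x → enabled x , refl) ,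
      γ₂⁻¹-attach (tgt e) offset'
      where
      g' : F
      g' = nextOffset e Ee g
      et : Edge LocT (Act G) n
      et = liftEdge e Ee g
      corr : Corresponds e g g' et
      corr = liftEdge-corresponds e Ee g
      vt' : Fin n → Carrier
      vt' x = resetVal (rst et x) (vt x + t * ι 1ℚ)
      enabled : ∀ x → (vt x + t * ι 1ℚ) ∈I guard et x
      enabled x = Equivalence.from (elapsed-guard-transfer e g g' et corr vt v off (src e) t x)
                                   (proj₁ (e-sem x))
      offset' : Offset g' vt' v'
      offset' x = trans (proj₂ (e-sem x))
                        (elapsed-reset-transfer e g g' et corr vt v off (src e) t x)

    γ₂⁻¹-isSimulation : IsSimulation GT G (γ₂⁻¹ R)
    γ₂⁻¹-isSimulation (inj₁ (l , g) , vt) (_ , v) (refl , off) =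
      inj₁ (tt , tt) , refl , (λ _ → simulate-GT-move (inj₁ l) g vt v off) , λ ()
    γ₂⁻¹-isSimulation (inj₂ (l , g) , vt) (_ , v) (refl , off) =
      inj₂ (tt , tt) , refl , (λ ()) , λ _ → simulate-G-move (inj₂ l) g vt v off

lemma9 : (R : OrderedQRing) {n : ℕ} {Obs : Set} (G : Game n Obs) →
    IsUpdatableTimed G →
    Semantics.Witnesses R (Construction.GT G) G (Construction.γ₂⁻¹ G R)
lemma9 R G updatable = γ₂⁻¹-isSimulation R G updatable , γ₂⁻¹-initial R G
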